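{- Let $n\ge 2$, let $\mathcal{V}=\{v_1,\dots,v_n\}$, and let $N_1,\dots,N_n$ be unary connectives, each interpreted by some truth-table $\mathcal{V}\to\mathcal{V}$. Let $\vdash$ denote derivability of located sequents in the natural-deduction system $\mathcal{N}^n$ (described in the context) for this language. Call $v_j\in\mathcal{V}$ a \emph{truth} if for every $1\le i\le n$, every formula $\varphi$ and all finite sets $\Gamma,\Delta$ of located formulas, the sequent $\Gamma:\Delta,(N_i\varphi,j)$ and the sequent $\Gamma:\Delta,\{(\varphi,k)\mid k\ne i\}$ are interderivable in $\mathcal{N}^n$ (each is derivable from the other taken as a premise). If both $v_j$ and $v_k$ are truths, then $j=k$.
   Context: A located formula is a pair $(\varphi,k)$ with $\varphi$ a formula of the propositional language built from atoms with the connectives $N_1,\dots,N_n$, and $k\in\{1,\dots,n\}$; it is meant to associate $\varphi$ with the truth-value $v_k$. A located sequent has the form $\Gamma:\Delta$ with $\Gamma,\Delta$ finite sets of located formulas; "$\Gamma:\Delta,(\psi,k)$" means $\Gamma:\Delta\cup\{(\psi,k)\}$, and for a set $S$ of located formulas "$\Gamma:\Delta,S$" means $\Gamma:\Delta\cup S$. A valuation $\sigma$ assigns each atom a value in $\mathcal{V}$ and extends to all formulas by the truth-tables of the connectives; $\sigma$ satisfies $\Gamma:\Delta$ iff whenever $\sigma(\varphi)=v_k$ for all $(\varphi,k)\in\Gamma$, then $\sigma(\psi)=v_j$ for some $(\psi,j)\in\Delta$. The system $\mathcal{N}^n$ (sound and complete for this semantics) has: initial sequents $\Gamma,(\varphi,i):\Delta,(\varphi,i)$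 for each $i$; right shift: from $\Gamma,(\varphi,i):\Delta$ infer $\Gamma:\Delta,\{(\varphi,k)\mid k\ne i\}$; left shift: from $\Gamma:\Delta,(\varphi,i)$ infer $\Gamma,(\varphi,j):\Delta$ for $j\ne i$; coordination $(c_{i,j})$, $i\ne j$: from $\Gamma:\Delta,(\varphi,i)$ and $\Gamma:\Delta,(\varphi,j)$ infer $\Gamma:\Delta$ (weakening on both sides is derivable); and, for each connective $*$ of arity $p$, operational rules generated from its truth-table: if $*(v_{i_1},\dots,v_{i_p})=v_k$, then from $\Gamma:\Delta,(\varphi_m,i_m)$ for $m=1,\dots,p$ infer $\Gamma:\Delta,(*(\varphi_1,\dots,\varphi_p),k)$; and for each $k$, from $\Gamma:\Delta,(*(\varphi_1,\dots,\varphi_p),k)$ together with all sequents $\Gamma,(\varphi_1,k_1),\dots,(\varphi_p,k_p):\Delta$ for which $*(v_{k_1},\dots,v_{k_p})=v_k$, infer $\Gamma:\Delta$. -}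

module Defs where

open import Data.Nat using (ℕ)
open import Data.Fin using (Fin; _≟_)
open import Data.List using (List; []; _∷_; _++_; map; filter; allFin)
open import Data.List.Membership.Propositional using (_∈_)
open import Data.Product using (_×_; _,_)
open import Relation.Nullary using (¬_; ¬?)
open import Relation.Binary.PropositionalEquality using (_≡_)

data Formula (n : ℕ) : Set where
  atom : ℕ → Formula n
  N    : Fin n → Formula n → Formula n

-- Truth-tables of the n unary connectives: table i is the table of N_i.
Tables : ℕ → Set
Tables n = Fin n → Fin n → Fin n

LFormula : ℕ → Set
LFormula n = Formula n × Fin n

-- Finite sets of located formulas are represented by lists; two lists
-- denote the same set when they have the same members.
LSet : ℕ → Set
LSet n = List (LFormula n)

_⊆_ : ∀ {n} → LSet n → LSet n → Set
xs ⊆ ys = ∀ {x} → x ∈ xs → x ∈ ys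

SameSet : ∀ {n} → LSet n → LSet n → Set
SameSet xs ys = (xs ⊆ ys) × (ys ⊆ xs)

record Sequent (n : ℕ) : Set where
  constructor _∶_
  field
    ante : LSet n
    succ : LSet n

others : ∀ {n} → Formula n → Fin n → LSet n
others {n} φ i = map (λ k → φ , k) (filter (λ k → ¬? (k ≟ i)) (allFin n))

data Derives {n : ℕ} (t : Tables n) (Hyp : Sequent n → Set) : Sequent n → Set where
  hyp : ∀ {S} → Hyp S → Derives t Hyp S
  -- sequents are sets: list representations with the same members are identified
  same : ∀ {Γ Δ Γ′ Δ′} → SameSet Γ Γ′ → SameSet Δ Δ′ →
         Derives t Hyp (Γ ∶ Δ) → Derives t Hyp (Γ′ ∶ Δ′)
  ax : ∀ {Γ Δ φ i} → Derives t Hyp (((φ , i) ∷ Γ) ∶ ((φ , i) ∷ Δ))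
  shiftR : ∀ {Γ Δ φ i} → Derives t Hyp (((φ , i) ∷ Γ) ∶ Δ) →
           Derives t Hyp (Γ ∶ (Δ ++ others φ i))
  shiftL : ∀ {Γ Δ φ i j} → ¬ (j ≡ i) → Derives t Hyp (Γ ∶ ((φ , i) ∷ Δ)) →
           Derives t Hyp (((φ , j) ∷ Γ) ∶ Δ)
  coord : ∀ {Γ Δ φ i j} → ¬ (i ≡ j) →
          Derives t Hyp (Γ ∶ ((φ , i) ∷ Δ)) → Derives t Hyp (Γ ∶ ((φ , j) ∷ Δ)) →
          Derives t Hyp (Γ ∶ Δ)
  intro : ∀ {Γ Δ φ} (l i : Fin n) → Derives t Hyp (Γ ∶ ((φ , i) ∷ Δ)) →
          Derives t Hyp (Γ ∶ ((N l φ , t l i) ∷ Δ))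
  elim : ∀ {Γ Δ φ} (l k : Fin n) → Derives t Hyp (Γ ∶ ((N l φ , k) ∷ Δ)) →
         (∀ k₁ → t l k₁ ≡ k → Derives t Hyp (((φ , k₁) ∷ Γ) ∶ Δ)) →
         Derives t Hyp (Γ ∶ Δ)

_⊢from_ : ∀ {n} → Tables n → Sequent n → Sequent n → Set
(t ⊢from S) S′ = Derives t (λ X → X ≡ S) S′

IsTruth : ∀ {n} → Tables n → Fin n → Set
IsTruth {n} t j = ∀ (i : Fin n) (φ : Formula n) (Γ Δ : LSet n) →
  (t ⊢from (Γ ∶ ((N i φ , j) ∷ Δ))) (Γ ∶ (Δ ++ others φ i)) ×
  (t ⊢from (Γ ∶ (Δ ++ others φ i))) (Γ ∶ ((N i φ , j) ∷ Δ))

{-# OPTIONS --safe #-}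
-- 𝒩ⁿ is sound for the truth-table semantics. If v_j is a truth, take i ≠ v and
-- the valuation sending the atom p to v: the sequent  : {(p,k) | k ≠ i}  is
-- satisfied, so the interderivable sequent  : (N_i p , j)  is satisfied as
-- well, i.e. the table of N_i sends v to j. Hence a truth is determined by the
-- tables, and two truths coincide.
module Submission where

open import Defs
open import Data.Nat using (ℕ; _≤_; suc; s≤s; z≤n)
open import Data.Fin using (Fin; _≟_; zero; suc)
open import Data.List using (_∷_; [])
open import Data.List.Membership.Propositional using (_∈_)
open import Data.List.Membership.Propositional.Properties
  using (∈-map⁺; ∈-filter⁺; ∈-allFin; ∈-++⁺ˡ; ∈-++⁺ʳ)
open import Data.List.Relation.Unary.Any using (here; there)
open import Data.Product using (∃; _×_; _,_; proj₂)
open import Data.Empty using (⊥-elim)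
open import Relation.Nullary using (¬?; yes; no)
open import Relation.Binary.PropositionalEquality using (_≡_; _≢_; refl; sym; trans; cong)

∈-others : ∀ {n} {φ : Formula n} {i k : Fin n} → k ≢ i → (φ , k) ∈ others φ i
∈-others {i = i} {k} k≢i =
  ∈-map⁺ _ (∈-filter⁺ (λ k → ¬? (k ≟ i)) (∈-allFin k) k≢i)

module Semantics {n : ℕ} (t : Tables n) (ρ : ℕ → Fin n) where

  eval : Formula n → Fin n
  eval (atom a) = ρ a
  eval (N l φ)  = t l (eval φ)

  Holds : LFormula n → Set
  Holds (φ , k) = eval φ ≡ k

  AllHold : LSet n → Set
  AllHold Γ = ∀ {x} → x ∈ Γ → Holds x

  SomeHolds : LSet n → Set
  SomeHolds Δ = ∃ λ x → x ∈ Δ × Holds x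

  Satisfies : Sequent n → Set
  Satisfies (Γ ∶ Δ) = AllHold Γ → SomeHolds Δ

  AllHold-∷ : ∀ {x Γ} → Holds x → AllHold Γ → AllHold (x ∷ Γ)
  AllHold-∷ hx hΓ (here refl) = hx
  AllHold-∷ hx hΓ (there x∈Γ) = hΓ x∈Γ

  sound : ∀ {Hyp S} → (∀ {S} → Hyp S → Satisfies S) → Derives t Hyp S → Satisfies S
  sound hyps (hyp h) hΓ = hyps h hΓ
  sound hyps (same (Γ⊆Γ′ , _) (Δ⊆Δ′ , _) d) hΓ′ with sound hyps d (λ x∈Γ → hΓ′ (Γ⊆Γ′ x∈Γ))
  ... | x , x∈Δ , hx = x , Δ⊆Δ′ x∈Δ , hx
  sound hyps ax hΓ = _ , here refl , hΓ (here refl)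
  sound hyps (shiftR {Δ = Δ} {φ} {i} d) hΓ with eval φ ≟ i
  ... | no  φ≢i = (φ , eval φ) , ∈-++⁺ʳ Δ (∈-others φ≢i) , refl
  ... | yes φ≡i with sound hyps d (AllHold-∷ φ≡i hΓ)
  ...   | x , x∈Δ , hx = x , ∈-++⁺ˡ x∈Δ , hx
  sound hyps (shiftL j≢i d) hΓ with sound hyps d (λ x∈Γ → hΓ (there x∈Γ))
  ... | _ , here refl  , φ≡i = ⊥-elim (j≢i (trans (sym (hΓ (here refl))) φ≡i))
  ... | x , there x∈Δ , hx  = x , x∈Δ , hx
  sound hyps (coord i≢j dᵢ dⱼ) hΓ with sound hyps dᵢ hΓ | sound hyps dⱼ hΓ
  ... | _ , here refl , φ≡i | _ , here refl , φ≡j = ⊥-elim (i≢j (trans (sym φ≡i) φ≡j))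
  ... | x , there x∈Δ , hx | _                     = x , x∈Δ , hx
  ... | _ , here refl , _   | x , there x∈Δ , hx   = x , x∈Δ , hx
  sound hyps (intro l i d) hΓ with sound hyps d hΓ
  ... | _ , here refl , φ≡i  = _ , here refl , cong (t l) φ≡i
  ... | x , there x∈Δ , hx  = x , there x∈Δ , hx
  sound hyps (elim {φ = φ} l k d minors) hΓ with sound hyps d hΓ
  ... | _ , here refl , Nφ≡k = sound hyps (minors (eval φ) Nφ≡k) (AllHold-∷ refl hΓ)
  ... | x , there x∈Δ , hx  = x , x∈Δ , hx

open Semantics

IsTruth⇒table≡ : ∀ {n} {t : Tables n} {j : Fin n} → IsTruth t j →
  ∀ i v → v ≢ i → t i v ≡ j
IsTruth⇒table≡ {n} {t} {j} truth i v v≢i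
  with sound t ρ premiseHolds (proj₂ (truth i p [] [])) (λ ())
  where
    ρ : ℕ → Fin n
    ρ _ = v

    p : Formula n
    p = atom 0

    premiseHolds : ∀ {S} → S ≡ ([] ∶ others p i) → Satisfies t ρ S
    premiseHolds refl _ = (p , v) , ∈-others v≢i , refl
... | _ , here refl , Np≡j = Np≡j

mainTheorem1 : (n : ℕ) → 2 ≤ n → (t : Tables n) → (j k : Fin n) →
    IsTruth t j → IsTruth t k → j ≡ k
mainTheorem1 (suc (suc m)) (s≤s (s≤s z≤n)) t j k truth-j truth-k =
  trans (sym (table≡ truth-j)) (table≡ truth-k)
  where
    table≡ : ∀ {l} → IsTruth t l → t zero (suc zero) ≡ l
    table≡ truth = IsTruth⇒table≡ truth zero (suc zero) (λ ())
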